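{- Let $\Sigma$ be a finite alphabet, $D \subseteq \Sigma^2$, and $w = w_1 w_2 \dots w_n$ a word over $\Sigma$. Suppose $i < k$ are indices with $w_i = w_k$, and $j \in \{1,\dots,n\}\setminus\{i,k\}$ is a vertex of the letter graph $\Gamma_D(w)$ that is adjacent to exactly one of the vertices $i$ and $k$. Then $i < j < k$.
   Context: Given a finite alphabet $\Sigma$, a set $D \subseteq \Sigma^2$ (the decoder), and a word $w = w_1 \dots w_n$ with each $w_i \in \Sigma$, the letter graph $\Gamma_D(w)$ is the simple graph with vertex set $\{1,\dots,n\}$ in which, for $p < q$, the vertices $p$ and $q$ are adjacent if and only if $(w_p, w_q) \in D$. -}

module Defs where

open import Data.Nat using (ℕ)
open import Data.Fin using (Fin; _<_)
open import Data.Product using (_×_)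
open import Data.Sum using (_⊎_)
open import Relation.Nullary using (¬_)

-- Finite alphabet Σ = Fin m; a word of length n is w : Fin n → Fin m
-- (positions 0..n-1 stand for 1..n). A decoder D ⊆ Σ² is a relation
-- D : Fin m → Fin m → Set ((a , b) ∈ D iff D a b).
Word : ℕ → ℕ → Set
Word m n = Fin n → Fin m

Decoder : ℕ → Set₁
Decoder m = Fin m → Fin m → Set

Adj : ∀ {m n} → Decoder m → Word m n → Fin n → Fin n → Set
Adj D w p q = (p < q × D (w p) (w q)) ⊎ (q < p × D (w q) (w p))

AdjExactlyOne : ∀ {m n} → Decoder m → Word m n → Fin n → Fin n → Fin n → Set
AdjExactlyOne D w x y z = (Adj D w x y × ¬ Adj D w x z) ⊎ (¬ Adj D w x y × Adj D w x z)

module Submission where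

-- In the letter graph, whether a vertex j is adjacent to a
-- vertex p is determined by two data only: the side of j on which p lies
-- (p < j or j < p) and the letter w p.  Hence if w i ≡ w k and i, k lie on
-- the same side of j, then j is adjacent to i exactly when it is adjacent
-- to k, so j cannot be adjacent to exactly one of them.

open import Defs
open import Data.Fin using (Fin; _<_)
open import Data.Product using (_×_; _,_)
open import Data.Sum using (inj₁; inj₂)
open import Data.Empty using (⊥-elim)
open import Relation.Nullary using (¬_)
open import Relation.Binary using (tri<; tri≈; tri>)
open import Data.Fin.Properties using (<-cmp; <-trans; <-asym)
open import Relation.Binary.PropositionalEquality using (_≡_; _≢_; subst; sym)

module _ {m n} (D : Decoder m) (w : Word m n) where

  adj-right : ∀ {j p} → j < p → Adj D w j p → D (w j) (w p)
  adj-right j<p (inj₁ (_ , d))   = d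
  adj-right j<p (inj₂ (p<j , _)) = ⊥-elim (<-asym j<p p<j)

  adj-left : ∀ {j p} → p < j → Adj D w j p → D (w p) (w j)
  adj-left p<j (inj₁ (j<p , _)) = ⊥-elim (<-asym j<p p<j)
  adj-left p<j (inj₂ (_ , d))   = d

  transfer-right : ∀ {j p q} → w p ≡ w q → j < p → j < q →
                   Adj D w j p → Adj D w j q
  transfer-right {j} wp≡wq j<p j<q a =
    inj₁ (j<q , subst (D (w j)) wp≡wq (adj-right j<p a))

  transfer-left : ∀ {j p q} → w p ≡ w q → p < j → q < j →
                  Adj D w j p → Adj D w j q
  transfer-left {j} wp≡wq p<j q<j a =
    inj₂ (q<j , subst (λ x → D x (w j)) wp≡wq (adj-left p<j a))

  not-exactly-one : ∀ {j y z} → (Adj D w j y → Adj D w j z) →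
                    (Adj D w j z → Adj D w j y) → ¬ AdjExactlyOne D w j y z
  not-exactly-one y⇒z z⇒y (inj₁ (ay , ¬az)) = ¬az (y⇒z ay)
  not-exactly-one y⇒z z⇒y (inj₂ (¬ay , az)) = ¬ay (z⇒y az)

lemma1 : ∀ {m n} (D : Decoder m) (w : Word m n) (i j k : Fin n) →
    i < k → w i ≡ w k → j ≢ i → j ≢ k →
    AdjExactlyOne D w j i k →
    (i < j × j < k)
lemma1 D w i j k i<k wi≡wk j≢i j≢k one with <-cmp i j | <-cmp j k
... | tri< i<j _ _ | tri< j<k _ _ = i<j , j<k
... | _            | tri≈ _ j≡k _ = ⊥-elim (j≢k j≡k)
... | tri≈ _ i≡j _ | _            = ⊥-elim (j≢i (sym i≡j))
... | tri> _ _ j<i | tri> _ _ k<j = ⊥-elim (<-asym i<k (<-trans k<j j<i))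
... | tri> _ _ j<i | tri< j<k _ _ = ⊥-elim (not-exactly-one D w
      (transfer-right D w wi≡wk j<i j<k)
      (transfer-right D w (sym wi≡wk) j<k j<i) one)
... | tri< i<j _ _ | tri> _ _ k<j = ⊥-elim (not-exactly-one D w
      (transfer-left D w wi≡wk i<j k<j)
      (transfer-left D w (sym wi≡wk) k<j i<j) one)
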